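{- Let $T$ be a rooted spanning tree on a finite node set $\mathcal{V}$ and let $\mathcal{E}\subseteq\mathcal{V}\times\mathcal{V}$ be a set of pairs each of which consists of two nodes one of which is an ancestor of the other in $T$. If $P$ is a directed $u$–$v$ path using arcs of $\mathcal{E}$, then $P$ passes through some $a\in\mathrm{anc}_T(u)\cap\mathrm{anc}_T(v)$ such that $(u,a),(a,v)\in\mathcal{E}[\mathrm{desc}_T(a)]^{\rm tr}$.
   Context: $\mathrm{anc}_T(x)$ and $\mathrm{desc}_T(x)$ denote the sets of ancestors and descendants of $x$ in $T$, each including $x$. For $U\subseteq\mathcal{V}$, $\mathcal{E}[U]$ is the set of arcs of $\mathcal{E}$ with both endpoints in $U$. For an arc set $A$, $(x,y)\in A^{\rm tr}$ means that $A$ contains a directed $x$–$y$ path (a path of length zero when $x=y$). -}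

module Defs where

open import Data.Nat using (ℕ)
open import Data.Fin using (Fin)
open import Data.Maybe using (Maybe; just; nothing)
open import Data.List using (List; []; _∷_)
open import Data.Product using (_×_)
open import Relation.Binary.PropositionalEquality using (_≡_)
open import Relation.Binary.Construct.Closure.ReflexiveTransitive
  using (Star; ε; _◅_)

-- Every node reaches the root by following parent pointers, and the root
-- has no parent; together this forces acyclicity and uniqueness of the root.
module _ {n : ℕ} where

  data ParentChain (parent : Fin n → Maybe (Fin n)) (a : Fin n) : Fin n → Set where
    here : ParentChain parent a a
    up   : ∀ {x y} → parent x ≡ just y → ParentChain parent a y → ParentChain parent a x

record RootedTree (n : ℕ) : Set where
  field
    root        : Fin n
    parent      : Fin n → Maybe (Fin n)
    root-parent : parent root ≡ nothing
    reach-root  : ∀ x → ParentChain parent root x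

module _ {n : ℕ} (T : RootedTree n) where
  open RootedTree T

  -- a ∈ anc_T(x)  (equivalently x ∈ desc_T(a)); includes a = x.
  IsAnc : Fin n → Fin n → Set
  IsAnc a x = ParentChain parent a x

Restrict : ∀ {n} → RootedTree n → (Fin n → Fin n → Set) → Fin n → Fin n → Fin n → Set
Restrict T E a x y = E x y × IsAnc T a x × IsAnc T a y

-- A^tr : (x , y) ∈ A^tr iff A contains a directed x–y path (length zero if x = y).
Tr : ∀ {n} → (Fin n → Fin n → Set) → Fin n → Fin n → Set
Tr A = Star A

verts : ∀ {n} {R : Fin n → Fin n → Set} {x y : Fin n} → Star R x y → List (Fin n)
verts {x = x} ε = x ∷ []
verts {x = x} (r ◅ p) = x ∷ verts p

module Submission where

-- Every arc joins two comparable nodes of T, so a walk cannot leave the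
-- subtree of its highest node: by induction along the walk, the walk has a
-- node that is an ancestor of all of its nodes (two ancestors of the same
-- node are comparable, so the higher of the current top and the new start
-- node is again a top). Cutting the walk at such a top a gives the two
-- walks u → a and a → v, all of whose arcs lie in E[desc_T(a)].

open import Defs
open import Data.Nat using (ℕ)
open import Data.Fin using (Fin)
open import Data.Maybe using (Maybe)
open import Data.Product using (Σ; _×_; _,_)
open import Data.Sum using (_⊎_; inj₁; inj₂)
open import Data.List using (List)
open import Data.List.Membership.Propositional using (_∈_)
open import Data.List.Relation.Unary.Any using (here; there)
open import Data.List.Relation.Unary.All as All using (All; _∷_)
open import Data.List.Relation.Unary.Unique.Propositional using (Unique)
open import Relation.Binary.Construct.Closure.ReflexiveTransitive using (Star; ε; _◅_)
open import Relation.Binary.PropositionalEquality using (_≡_; refl; sym; trans)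

module _ {n : ℕ} {parent : Fin n → Maybe (Fin n)} where

  ParentChain-trans : ∀ {a b x} → ParentChain parent a b → ParentChain parent b x
                    → ParentChain parent a x
  ParentChain-trans p here     = p
  ParentChain-trans p (up e q) = up e (ParentChain-trans p q)

  ParentChain-comparable : ∀ {a b x} → ParentChain parent a x → ParentChain parent b x
                         → ParentChain parent a b ⊎ ParentChain parent b a
  ParentChain-comparable here     q         = inj₂ q
  ParentChain-comparable p        here      = inj₁ p
  ParentChain-comparable (up e p) (up e′ q) with trans (sym e) e′
  ... | refl = ParentChain-comparable p q

module _ {n : ℕ} {E : Fin n → Fin n → Set} where

  All-verts-head : ∀ {Q : Fin n → Set} {x y} (P : Star E x y) → All Q (verts P) → Q x
  All-verts-head ε       qs = All.head qs
  All-verts-head (_ ◅ _) qs = All.head qs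

  last∈verts : ∀ {x y} (P : Star E x y) → y ∈ verts P
  last∈verts ε       = here refl
  last∈verts (_ ◅ P) = there (last∈verts P)

  module _ {U : Fin n → Set} where

    Inside : Fin n → Fin n → Set
    Inside x y = E x y × U x × U y

    walk-inside : ∀ {x y} (P : Star E x y) → All U (verts P) → Star Inside x y
    walk-inside ε       _        = ε
    walk-inside (e ◅ P) (q ∷ qs) = (e , q , All-verts-head P qs) ◅ walk-inside P qs

    split-walk-inside : ∀ {a x y} (P : Star E x y) → a ∈ verts P → All U (verts P)
                      → Star Inside x a × Star Inside a y
    split-walk-inside ε       (here refl) _        = ε , ε
    split-walk-inside (e ◅ P) (here refl) qs       = ε , walk-inside (e ◅ P) qs
    split-walk-inside (e ◅ P) (there m)   (q ∷ qs) with split-walk-inside P m qs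
    ... | P₁ , P₂ = (e , q , All-verts-head P qs) ◅ P₁ , P₂

module _ {n : ℕ} (T : RootedTree n) where

  Top : List (Fin n) → Set
  Top xs = Σ (Fin n) λ a → a ∈ xs × All (IsAnc T a) xs

  top-of-comparable-walk : {E : Fin n → Fin n → Set}
    → (∀ x y → E x y → IsAnc T x y ⊎ IsAnc T y x)
    → ∀ {x y} (P : Star E x y) → Top (verts P)
  top-of-comparable-walk h {x} ε = x , here refl , here ∷ All.[]
  top-of-comparable-walk h {x} (_◅_ {j = w} e P)
    with top-of-comparable-walk h P
  ... | a , a∈P , a-top with All-verts-head P a-top | h x w e
  ...   | a-w | inj₂ w-x = a , there a∈P , ParentChain-trans a-w w-x ∷ a-top
  ...   | a-w | inj₁ x-w with ParentChain-comparable x-w a-w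
  ...     | inj₁ x-a = x , here refl , here ∷ All.map (ParentChain-trans x-a) a-top
  ...     | inj₂ a-x = a , there a∈P , a-x ∷ a-top

lemma7p10 : (n : ℕ) (T : RootedTree n) (E : Fin n → Fin n → Set)
    → (∀ x y → E x y → IsAnc T x y ⊎ IsAnc T y x)
    → (u v : Fin n) (P : Star E u v) → Unique (verts P)
    → Σ (Fin n) λ a → (a ∈ verts P) × IsAnc T a u × IsAnc T a v
        × Tr (Restrict T E a) u a × Tr (Restrict T E a) a v
lemma7p10 n T E comparable u v P _ with top-of-comparable-walk T comparable P
... | a , a∈P , a-top with split-walk-inside P a∈P a-top
... | P₁ , P₂ = a , a∈P , All-verts-head P a-top , All.lookup a-top (last∈verts P) , P₁ , P₂
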